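{- None of the logics $\mathrm{FRGF}[\cdot^{+},?]$, $\mathrm{FRGF}[\cdot^{+},\cdot^{*}]$, $\mathrm{FRGF}[\cdot^{+},\bar{\cdot}]$ and $\mathrm{FRGF}[\cdot^{+},\circ]$ has the finite model property (i.e., each of them contains a satisfiable sentence with no finite model).
   Context: $\mathrm{RGF}$: fix a countably infinite relational signature $\Sigma=\Sigma_{\mathrm{FO}}\sqcup\Sigma_{\mathrm{reg}}$ without equality and constants, predicates in $\Sigma_{\mathrm{reg}}$ binary. Programs: $\pi,\rho ::= B\mid\bar B\mid\pi\circ\rho\mid\pi\cup\rho\mid\pi\cap\rho\mid\pi^*\mid\pi^+\mid\psi?$ with $B\in\Sigma_{\mathrm{reg}}$, $\psi$ an $\mathrm{RGF}$-formula with one free variable; $\bar\pi$ is the converse, $\circ$ composition, $\pi^*$ reflexive-transitive closure, $\pi^+$ transitive closure, $\psi?=\{(a,a):\psi \text{ holds at } a\}$. An $\mathrm{RGF}$-guard for $\varphi$ is an atom over $\Sigma_{\mathrm{FO}}$ or $\pi(x,y)$ for a program $\pi$, whose free variables include those of $\varphi$. $\mathrm{RGF}$-formulas: $\varphi ::= A(\bar x)\mid\neg\varphi\mid\varphi\wedge\varphi'\mid\exists x\,\varphi(x)\mid\exists\bar x(\vartheta\wedge\varphi)$, $A\in\Sigma_{\mathrm{FO}}$, $\varphi(x)$ with no free variable besides $x$, $\vartheta$ an $\mathrm{RGF}$-guard for $\varphi$. For a set $S$ of program operators, $\mathrm{RGF}[S]$ restricts programs to operators from $S$ ($?$ denotes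 tests, $\bar\cdot$ converse). A formula is index-normal if on every branch of its syntax tree the $i$-th quantifier binds exactly $x_i$; forward if moreover every atom $\alpha(\bar x)$ (including guard atoms) in the scope of a quantifier binding $x_n$ (but not $x_{n+1}$) has $\bar x$ an infix of $x_1,\dots,x_n$. $\mathrm{FRGF}[S]$ is the set of forward $\mathrm{RGF}[S]$-sentences. -}

module Defs where

open import Data.Nat using (ℕ; zero; suc; _+_; _≟_; _≡ᵇ_)
open import Data.Bool using (if_then_else_)
open import Data.Fin using (Fin)
open import Data.List using (List; []; _∷_; _++_; filter; upTo; length; map)
open import Data.Vec using (Vec) renaming (toList to vtoList; map to vmap)
open import Data.List.Membership.Propositional using (_∈_)
open import Data.List.Membership.DecPropositional _≟_ using (_∈?_)
open import Data.List.Relation.Binary.Subset.Propositional using (_⊆_)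
open import Data.List.Relation.Binary.Infix.Heterogeneous using (Infix)
open import Data.Product using (Σ; _×_)
open import Data.Sum using (_⊎_)
open import Data.Unit using (⊤)
open import Relation.Nullary using (¬_; ¬?)
open import Relation.Binary.PropositionalEquality using (_≡_)
open import Relation.Binary.Construct.Closure.ReflexiveTransitive using (Star)
open import Relation.Binary.Construct.Closure.Transitive using (TransClosure)
open import Function.Bundles using (_↔_)

-- Variables are x₀, x₁, x₂, … (represented by ℕ; the paper's
-- x_i is our x_{i-1}).  Σ_FO: for every arity k countably many symbols
-- (k , i).  Σ_reg: countably many binary symbols, indexed by ℕ.
-- No equality, no constants.

Var : Set
Var = ℕ

data Op : Set where
  conv comp union inter star plus test : Op

mutual
  data Prog : Set where
    atom   : ℕ → Prog
    catom  : ℕ → Prog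
    _∘ₚ_   : Prog → Prog → Prog
    _∪ₚ_   : Prog → Prog → Prog
    _∩ₚ_   : Prog → Prog → Prog
    _*ₚ    : Prog → Prog
    _⁺ₚ    : Prog → Prog
    _¿     : (Var × Fm) → Prog        -- test ψ? ; the Var names ψ's free variable

  data Guard : Set where
    gatom : (k i : ℕ) → Vec Var k → Guard
    gprog : Prog → Var → Var → Guard

  data Fm : Set where
    atom : (k i : ℕ) → Vec Var k → Fm
    neg  : Fm → Fm
    and  : Fm → Fm → Fm
    ex   : Var → Fm → Fm
    gex  : List Var → Guard → Fm → Fm

removeAll : List Var → List Var → List Var
removeAll xs = filter (λ y → ¬? (y ∈? xs))

FVg : Guard → List Var
FVg (gatom k i xs) = vtoList xs
FVg (gprog π x y)  = x ∷ y ∷ []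

FV : Fm → List Var
FV (atom k i xs)  = vtoList xs
FV (neg φ)        = FV φ
FV (and φ ψ)      = FV φ ++ FV ψ
FV (ex x φ)       = removeAll (x ∷ []) (FV φ)
FV (gex xs θ φ)   = removeAll xs (FVg θ ++ FV φ)

-- Well-formedness (the side conditions of the RGF grammar)

mutual
  WFP : Prog → Set
  WFP (atom B)    = ⊤
  WFP (catom B)   = ⊤
  WFP (π ∘ₚ ρ)    = WFP π × WFP ρ
  WFP (π ∪ₚ ρ)    = WFP π × WFP ρ
  WFP (π ∩ₚ ρ)    = WFP π × WFP ρ
  WFP (π *ₚ)      = WFP π
  WFP (π ⁺ₚ)      = WFP π
  WFP ((x Data.Product., ψ) ¿) = (FV ψ ⊆ x ∷ []) × WF ψ

  WFG : Guard → Set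
  WFG (gatom k i xs) = ⊤
  WFG (gprog π x y)  = WFP π

  WF : Fm → Set
  WF (atom k i xs) = ⊤
  WF (neg φ)       = WF φ
  WF (and φ ψ)     = WF φ × WF ψ
  WF (ex x φ)      = (FV φ ⊆ x ∷ []) × WF φ
  WF (gex xs θ φ)  = (FV φ ⊆ FVg θ) × WFG θ × WF φ

mutual
  OpsP : List Op → Prog → Set
  OpsP S (atom B)  = ⊤
  OpsP S (catom B) = conv ∈ S
  OpsP S (π ∘ₚ ρ)  = comp ∈ S × OpsP S π × OpsP S ρ
  OpsP S (π ∪ₚ ρ)  = union ∈ S × OpsP S π × OpsP S ρ
  OpsP S (π ∩ₚ ρ)  = inter ∈ S × OpsP S π × OpsP S ρ
  OpsP S (π *ₚ)    = star ∈ S × OpsP S π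
  OpsP S (π ⁺ₚ)    = plus ∈ S × OpsP S π
  OpsP S ((x Data.Product., ψ) ¿) = test ∈ S × Ops S ψ

  OpsG : List Op → Guard → Set
  OpsG S (gatom k i xs) = ⊤
  OpsG S (gprog π x y)  = OpsP S π

  Ops : List Op → Fm → Set
  Ops S (atom k i xs) = ⊤
  Ops S (neg φ)       = Ops S φ
  Ops S (and φ ψ)     = Ops S φ × Ops S ψ
  Ops S (ex x φ)      = Ops S φ
  Ops S (gex xs θ φ)  = OpsG S θ × Ops S φ

-- Forward (and index-normal) formulas.  `n` = number of quantifiers on the
-- branch so far; the variables bound are x₀ … x_{n-1} = upTo n.
-- The k-th quantifier of a block ∃x̄ counts as a separate quantifier, so a
-- block at depth n must be exactly x_n, …, x_{n+|x̄|-1}.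

range : ℕ → ℕ → List Var
range n zero    = []
range n (suc k) = n ∷ range (suc n) k

InfixOf : List Var → ℕ → Set
InfixOf xs n = Infix _≡_ xs (upTo n)

mutual
  FwdP : ℕ → Prog → Set
  FwdP n (atom B)  = ⊤
  FwdP n (catom B) = ⊤
  FwdP n (π ∘ₚ ρ)  = FwdP n π × FwdP n ρ
  FwdP n (π ∪ₚ ρ)  = FwdP n π × FwdP n ρ
  FwdP n (π ∩ₚ ρ)  = FwdP n π × FwdP n ρ
  FwdP n (π *ₚ)    = FwdP n π
  FwdP n (π ⁺ₚ)    = FwdP n π
  FwdP n ((x Data.Product., ψ) ¿) = Fwd n ψ

  FwdG : ℕ → Guard → Set
  FwdG n (gatom k i xs) = InfixOf (vtoList xs) n
  FwdG n (gprog π x y)  = InfixOf (x ∷ y ∷ []) n × FwdP n π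

  Fwd : ℕ → Fm → Set
  Fwd n (atom k i xs) = InfixOf (vtoList xs) n
  Fwd n (neg φ)       = Fwd n φ
  Fwd n (and φ ψ)     = Fwd n φ × Fwd n ψ
  Fwd n (ex x φ)      = (x ≡ n) × Fwd (suc n) φ
  Fwd n (gex xs θ φ)  = (xs ≡ range n (length xs))
                        × FwdG (n + length xs) θ × Fwd (n + length xs) φ

FRGF : List Op → Fm → Set
FRGF S φ = WF φ × Ops S φ × (FV φ ≡ []) × Fwd 0 φ

-- Semantics.  Structures have a nonempty domain (witness `elt`).

record Structure : Set₁ where
  field
    D   : Set
    elt : D
    FO  : (k i : ℕ) → Vec D k → Set
    Reg : ℕ → D → D → Set
open Structure public

module _ (M : Structure) where

  Assign : Set
  Assign = Var → D M

  _[_↦_] : Assign → Var → D M → Assign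
  (ρ [ x ↦ a ]) y = if y ≡ᵇ x then a else ρ y

  Block : List Var → Assign → (Assign → Set) → Set
  Block []       ρ P = P ρ
  Block (x ∷ xs) ρ P = Σ (D M) λ a → Block xs (ρ [ x ↦ a ]) P

  mutual
    ⟦_⟧ : Prog → Assign → D M → D M → Set
    ⟦ atom B ⟧ ρ a b  = Reg M B a b
    ⟦ catom B ⟧ ρ a b = Reg M B b a
    ⟦ π ∘ₚ σ ⟧ ρ a b  = Σ (D M) λ c → ⟦ π ⟧ ρ a c × ⟦ σ ⟧ ρ c b
    ⟦ π ∪ₚ σ ⟧ ρ a b  = ⟦ π ⟧ ρ a b ⊎ ⟦ σ ⟧ ρ a b
    ⟦ π ∩ₚ σ ⟧ ρ a b  = ⟦ π ⟧ ρ a b × ⟦ σ ⟧ ρ a b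
    ⟦ π *ₚ ⟧ ρ        = Star (⟦ π ⟧ ρ)
    ⟦ π ⁺ₚ ⟧ ρ        = TransClosure (⟦ π ⟧ ρ)
    ⟦ (x Data.Product., ψ) ¿ ⟧ ρ a b = (a ≡ b) × Sat (ρ [ x ↦ a ]) ψ

    SatG : Assign → Guard → Set
    SatG ρ (gatom k i xs) = FO M k i (vmap ρ xs)
    SatG ρ (gprog π x y)  = ⟦ π ⟧ ρ (ρ x) (ρ y)

    Sat : Assign → Fm → Set
    Sat ρ (atom k i xs) = FO M k i (vmap ρ xs)
    Sat ρ (neg φ)       = ¬ Sat ρ φ
    Sat ρ (and φ ψ)     = Sat ρ φ × Sat ρ ψ
    Sat ρ (ex x φ)      = Σ (D M) λ a → Sat (ρ [ x ↦ a ]) φ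
    Sat ρ (gex xs θ φ)  = Block xs ρ (λ ρ' → SatG ρ' θ × Sat ρ' φ)

-- M ⊨ φ for a sentence φ (assignment irrelevant; we use the constant one)
_⊨_ : Structure → Fm → Set
M ⊨ φ = Sat M (λ _ → elt M) φ

Satisfiable : Fm → Set₁
Satisfiable φ = Σ Structure λ M → M ⊨ φ

NoFiniteModel : Fm → Set₁
NoFiniteModel φ = (M : Structure) (n : ℕ) → (Fin (suc n) ↔ D M) → ¬ (M ⊨ φ)

NoFMP : List Op → Set₁
NoFMP S = Σ Fm λ φ → FRGF S φ × Satisfiable φ × NoFiniteModel φ

-- Every witness sentence makes B ∩ E serial.  On ℕ, B = E = successor is
-- serial and acyclic.  In a finite structure, iterating a serial relation must
-- revisit a point (pigeonhole), which gives a B ∩ E-cycle; constructively this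
-- holds only under ¬¬, which is enough to refute the sentence.  For π = ⊤? or
-- B₁* the sentence also says π ⊆ Q and Q ∩ B⁺ = ∅, and since π is reflexive,
-- a B-cycle through b puts (b, b) in both.  For π = B̄⁺ or B⁺ ∘ B it says that
-- no E-edge lies in π.  But every step x → y of a B ∩ E-cycle is such an edge,
-- because y reaches x along the rest of the cycle.
{-# OPTIONS --safe #-}
module Submission where

open import Defs
open import Data.Empty using (⊥)
open import Data.Fin as Fin using (Fin; toℕ)
open import Data.Fin.Properties using (pigeonhole; sequence)
open import Data.List using (List; []; _∷_; _++_; upTo)
open import Data.List.Membership.Propositional using (_∈_)
open import Data.List.Membership.Propositional.Properties using (∈-filter⁻; ∈-++⁻)
open import Data.List.Relation.Binary.Infix.Heterogeneous using (here)
open import Data.List.Relation.Binary.Prefix.Heterogeneous using (Prefix)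
open import Data.List.Relation.Binary.Subset.Propositional using (_⊆_)
open import Data.List.Relation.Binary.Subset.Propositional.Properties using (∈-∷⁺ʳ; ⊆[]⇒≡[])
open import Data.List.Relation.Unary.Any using (here; there)
open import Data.Nat using (ℕ; zero; suc; _<_)
open import Data.Nat.Properties using (<-irrefl; <-trans; <-asym; n<1+n; ≤-refl; ≤-reflexive; suc-injective)
open import Data.Product using (∃; ∃₂; _×_; _,_; proj₁; proj₂)
open import Data.Sum using (inj₁; inj₂; [_,_]′)
open import Data.Unit using (⊤; tt)
open import Data.Vec using (Vec; []; _∷_)
open import Effect.Monad using (RawMonad)
open import Function using (flip; _∘_; id)
open import Function.Bundles using (_↔_; _↣_; Inverse; Injection)
open import Function.Properties.Inverse using (↔⇒↣; ↔-sym)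
open import Induction.InfiniteDescent using (sequence⁺)
open import Relation.Binary.Construct.Closure.ReflexiveTransitive using (ε; _◅_)
open import Relation.Binary.Construct.Closure.Transitive using (TransClosure; [_]; _∷_; _∷ʳ_; transitive⁻)
open import Relation.Binary.PropositionalEquality using (_≡_; _≢_; refl; sym; trans; subst)
open import Relation.Nullary using (¬_; contradiction)
open import Relation.Nullary.Negation using (¬¬-Monad; ¬¬-map; ¬∃⟶∀¬)

module _ {A : Set} where

  map⁺ : {R R′ : A → A → Set} → (∀ {x y} → R x y → R′ x y) →
         ∀ {x y} → TransClosure R x y → TransClosure R′ x y
  map⁺ f [ r ]    = [ f r ]
  map⁺ f (r ∷ rs) = f r ∷ map⁺ f rs

  reverse⁺ : {R : A → A → Set} → ∀ {x y} →
             TransClosure R x y → TransClosure (flip R) y x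
  reverse⁺ [ r ]    = [ r ]
  reverse⁺ (r ∷ rs) = reverse⁺ rs ∷ʳ r

module _ {A : Set} {R : A → A → Set} where

  cycle⇒step : ∀ {b} → TransClosure R b b → ∃₂ λ x y → R x y × TransClosure R y x
  cycle⇒step [ r ]    = _ , _ , r , [ r ]
  cycle⇒step (r ∷ rs) = _ , _ , r , rs

  serial⇒cycle : ∀ {n} → A ↣ Fin n → A → (∀ a → ∃ (R a)) →
                 ∃ λ b → TransClosure R b b
  serial⇒cycle {n} inj a serial =
    let i , j , i<j , eq = pigeonhole (n<1+n n) (to ∘ orbit ∘ toℕ)
    in  orbit (toℕ i) , subst (TransClosure R _) (sym (injective eq)) (walk i<j)
    where
    open Injection inj using (to; injective)

    orbit : ℕ → A
    orbit zero    = a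
    orbit (suc k) = proj₁ (serial (orbit k))

    walk : ∀ {k l} → k < l → TransClosure R (orbit k) (orbit l)
    -- sequence⁺ is stated for descending chains, hence flip R.
    walk k<l =
      reverse⁺ (sequence⁺ {_<_ = flip R} (λ k → [ proj₂ (serial (orbit k)) ]) k<l)

¬¬-Π-finite : ∀ {n} {A : Set} {P : A → Set} → Fin n ↔ A →
              (∀ a → ¬ ¬ P a) → ¬ ¬ (∀ a → P a)
¬¬-Π-finite {P = P} iso h =
  ¬¬-map (λ p a → subst P (strictlyInverseˡ a) (p (from a)))
         (sequence (RawMonad.rawApplicative ¬¬-Monad) (h ∘ to))
  where open Inverse iso

finite-serial⇒¬¬cycle : ∀ {n} {A : Set} {R : A → A → Set} → Fin (suc n) ↔ A →
                        (∀ a → ¬ ¬ ∃ (R a)) → ¬ ¬ ∃ λ b → TransClosure R b b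
finite-serial⇒¬¬cycle iso h =
  ¬¬-map (serial⇒cycle (↔⇒↣ (↔-sym iso)) (Inverse.to iso Fin.zero)) (¬¬-Π-finite iso h)

removeAll-⊆ : ∀ {xs ys zs : List Var} → xs ⊆ zs ++ ys → removeAll ys xs ⊆ zs
removeAll-⊆ {zs = zs} xs⊆ y∈ with ∈-filter⁻ _ y∈
... | y∈xs , y∉ys with ∈-++⁻ zs (xs⊆ y∈xs)
...   | inj₁ y∈zs = y∈zs
...   | inj₂ y∈ys = contradiction y∈ys y∉ys

record FRGFₙ (S : List Op) (n : ℕ) (φ : Fm) : Set where
  constructor frgfₙ
  field
    fv  : FV φ ⊆ upTo n
    wf  : WF φ
    ops : Ops S φ
    fwd : Fwd n φ

record FRGFProg (S : List Op) (n : ℕ) (π : Prog) : Set where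
  constructor frgfProg
  field
    wf  : WFP π
    ops : OpsP S π
    fwd : FwdP n π

FRGFₙ⇒FRGF : ∀ {S φ} → FRGFₙ S 0 φ → FRGF S φ
FRGFₙ⇒FRGF (frgfₙ fv wf ops fwd) = wf , ops , ⊆[]⇒≡[] fv , fwd

neg-FRGFₙ : ∀ {S n φ} → FRGFₙ S n φ → FRGFₙ S n (neg φ)
neg-FRGFₙ (frgfₙ fv wf ops fwd) = frgfₙ fv wf ops fwd

and-FRGFₙ : ∀ {S n φ ψ} → FRGFₙ S n φ → FRGFₙ S n ψ → FRGFₙ S n (and φ ψ)
and-FRGFₙ {φ = φ} (frgfₙ fv wf ops fwd) (frgfₙ fv′ wf′ ops′ fwd′) =
  frgfₙ ([ fv , fv′ ]′ ∘ ∈-++⁻ (FV φ)) (wf , wf′) (ops , ops′) (fwd , fwd′)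

ex₀-FRGFₙ : ∀ {S ψ} → FRGFₙ S 1 ψ → FRGFₙ S 0 (ex 0 ψ)
ex₀-FRGFₙ (frgfₙ fv wf ops fwd) = frgfₙ (removeAll-⊆ fv) (fv , wf) ops (refl , fwd)

x₀x₁-infix : InfixOf (0 ∷ 1 ∷ []) 2
x₀x₁-infix = here (refl Prefix.∷ refl Prefix.∷ Prefix.[])

binaryAtom : ℕ → Fm
binaryAtom i = atom 2 i (0 ∷ 1 ∷ [])

binaryAtom-FRGF₂ : ∀ {S} i → FRGFₙ S 2 (binaryAtom i)
binaryAtom-FRGF₂ i = frgfₙ id tt tt x₀x₁-infix

∃Step : Prog → Fm → Fm
∃Step π φ = gex (1 ∷ []) (gprog π 0 1) φ

∃Step-FRGF₁ : ∀ {S π φ} → FRGFProg S 2 π → FRGFₙ S 2 φ → FRGFₙ S 1 (∃Step π φ)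
∃Step-FRGF₁ (frgfProg wfπ opsπ fwdπ) (frgfₙ fv wf ops fwd) = frgfₙ
  (removeAll-⊆ (∈-∷⁺ʳ (here refl) (∈-∷⁺ʳ (there (here refl)) fv)))
  (fv , wfπ , wf) (opsπ , ops) (refl , (x₀x₁-infix , fwdπ) , fwd)

B : Prog
B = atom 0

E Q : Fm
E = binaryAtom 0
Q = binaryAtom 1

∀∃Step ¬∃Step : Prog → Fm → Fm
∀∃Step π φ = neg (ex 0 (neg (∃Step π φ)))
¬∃Step π φ = neg (ex 0 (∃Step π φ))

serial : Fm
serial = ∀∃Step B E

reflexiveWitness cyclicWitness : Prog → Fm
reflexiveWitness π = and serial (and (¬∃Step π (neg Q)) (¬∃Step (B ⁺ₚ) Q))
cyclicWitness π    = and serial (¬∃Step π E)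

∀∃Step-FRGF₀ : ∀ {S π φ} → FRGFProg S 2 π → FRGFₙ S 2 φ → FRGFₙ S 0 (∀∃Step π φ)
∀∃Step-FRGF₀ π-FRGF φ-FRGF = neg-FRGFₙ (ex₀-FRGFₙ (neg-FRGFₙ (∃Step-FRGF₁ π-FRGF φ-FRGF)))

¬∃Step-FRGF₀ : ∀ {S π φ} → FRGFProg S 2 π → FRGFₙ S 2 φ → FRGFₙ S 0 (¬∃Step π φ)
¬∃Step-FRGF₀ π-FRGF φ-FRGF = neg-FRGFₙ (ex₀-FRGFₙ (∃Step-FRGF₁ π-FRGF φ-FRGF))

serial-FRGF₀ : ∀ {S} → FRGFₙ S 0 serial
serial-FRGF₀ = ∀∃Step-FRGF₀ (frgfProg tt tt tt) (binaryAtom-FRGF₂ 0)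

reflexiveWitness-FRGF₀ : ∀ {S π} → plus ∈ S → FRGFProg S 2 π →
                         FRGFₙ S 0 (reflexiveWitness π)
reflexiveWitness-FRGF₀ plus∈S π-FRGF = and-FRGFₙ serial-FRGF₀ (and-FRGFₙ
  (¬∃Step-FRGF₀ π-FRGF (neg-FRGFₙ (binaryAtom-FRGF₂ 1)))
  (¬∃Step-FRGF₀ (frgfProg tt (plus∈S , tt) tt) (binaryAtom-FRGF₂ 1)))

cyclicWitness-FRGF₀ : ∀ {S π} → FRGFProg S 2 π → FRGFₙ S 0 (cyclicWitness π)
cyclicWitness-FRGF₀ π-FRGF = and-FRGFₙ serial-FRGF₀ (¬∃Step-FRGF₀ π-FRGF (binaryAtom-FRGF₂ 0))

ℕ-successor : Structure
ℕ-successor = record { D = ℕ ; elt = 0 ; FO = FOₛ ; Reg = Regₛ }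
  where
  FOₛ : (k i : ℕ) → Vec ℕ k → Set
  FOₛ 2 0 (a ∷ b ∷ []) = b ≡ suc a
  FOₛ 2 1 (a ∷ b ∷ []) = a ≡ b
  FOₛ _ _ _            = ⊤

  Regₛ : ℕ → ℕ → ℕ → Set
  Regₛ 0       a b = b ≡ suc a
  Regₛ (suc _) _ _ = ⊥

CoreflexiveOnℕ : Prog → Set
CoreflexiveOnℕ π = ∀ ρ a b → ⟦_⟧ ℕ-successor π ρ a b → a ≡ b

MissesSuccessorOnℕ : Prog → Set
MissesSuccessorOnℕ π = ∀ ρ a b → ⟦_⟧ ℕ-successor π ρ a b → b ≢ suc a

succ⁺⇒< : ∀ {a b} → TransClosure (λ x y → y ≡ suc x) a b → a < b
succ⁺⇒< = transitive⁻ _<_ <-trans ∘ map⁺ λ { refl → ≤-refl }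

serial-ℕ : ℕ-successor ⊨ serial
serial-ℕ (a , no-successor) = no-successor (suc a , refl , refl)

reflexiveWitness-ℕ : ∀ {π} → CoreflexiveOnℕ π → ℕ-successor ⊨ reflexiveWitness π
reflexiveWitness-ℕ π⊆≡ =
  serial-ℕ ,
  (λ (a , b , πab , a≢b) → a≢b (π⊆≡ _ a b πab)) ,
  (λ (a , b , a<⁺b , a≡b) → <-irrefl a≡b (succ⁺⇒< a<⁺b))

cyclicWitness-ℕ : ∀ {π} → MissesSuccessorOnℕ π → ℕ-successor ⊨ cyclicWitness π
cyclicWitness-ℕ π∩succ=∅ = serial-ℕ , λ (a , b , πab , b≡1+a) → π∩succ=∅ _ a b πab b≡1+a

Edge : (M : Structure) → D M → D M → Set
Edge M a b = Reg M 0 a b × FO M 2 0 (a ∷ b ∷ [])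

serial⇒¬¬Edge-cycle : ∀ M {n} → Fin (suc n) ↔ D M → M ⊨ serial →
                      ¬ ¬ ∃ λ b → TransClosure (Edge M) b b
serial⇒¬¬Edge-cycle M iso s = finite-serial⇒¬¬cycle iso (¬∃⟶∀¬ s)

AlwaysReflexive : Prog → Set₁
AlwaysReflexive π = ∀ M ρ a → ⟦_⟧ M π ρ a a

RelatesCycleSteps : Prog → Set₁
RelatesCycleSteps π = ∀ M ρ x y → Reg M 0 x y → TransClosure (Reg M 0) y x → ⟦_⟧ M π ρ x y

reflexiveWitness-noFiniteModel : ∀ {π} → AlwaysReflexive π → NoFiniteModel (reflexiveWitness π)
reflexiveWitness-noFiniteModel π-refl M n iso (s , π⊆Q , Q∩B⁺=∅) =
  serial⇒¬¬Edge-cycle M iso s λ (b , cycle) →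
    π⊆Q (b , b , π-refl M _ b , λ Qbb → Q∩B⁺=∅ (b , b , map⁺ proj₁ cycle , Qbb))

cyclicWitness-noFiniteModel : ∀ {π} → RelatesCycleSteps π → NoFiniteModel (cyclicWitness π)
cyclicWitness-noFiniteModel π-relates M n iso (s , π∩E=∅) =
  serial⇒¬¬Edge-cycle M iso s λ (_ , cycle) →
    let x , y , (Bxy , Exy) , y→⁺x = cycle⇒step cycle
    in  π∩E=∅ (x , y , π-relates M _ x y Bxy (map⁺ proj₁ y→⁺x) , Exy)

reflexiveWitness-NoFMP : ∀ {S} π → plus ∈ S → FRGFProg S 2 π →
                         AlwaysReflexive π → CoreflexiveOnℕ π → NoFMP S
reflexiveWitness-NoFMP π plus∈S π-FRGF π-refl π⊆≡ =
  reflexiveWitness π , FRGFₙ⇒FRGF (reflexiveWitness-FRGF₀ {π = π} plus∈S π-FRGF) ,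
  (ℕ-successor , reflexiveWitness-ℕ {π = π} π⊆≡) ,
  reflexiveWitness-noFiniteModel {π = π} π-refl

cyclicWitness-NoFMP : ∀ {S} π → FRGFProg S 2 π →
                      RelatesCycleSteps π → MissesSuccessorOnℕ π → NoFMP S
cyclicWitness-NoFMP π π-FRGF π-relates π∩succ=∅ =
  cyclicWitness π , FRGFₙ⇒FRGF (cyclicWitness-FRGF₀ {π = π} π-FRGF) ,
  (ℕ-successor , cyclicWitness-ℕ {π = π} π∩succ=∅) ,
  cyclicWitness-noFiniteModel {π = π} π-relates

tautology : Fm
tautology = neg (and P (neg P))
  where
  P : Fm
  P = atom 0 0 []

⊤? : Prog
⊤? = (0 , tautology) ¿

⊤?-FRGF : ∀ {S n} → test ∈ S → FRGFProg S n ⊤?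
⊤?-FRGF test∈S = frgfProg ((λ ()) , tt , tt) (test∈S , tt , tt) (here Prefix.[] , here Prefix.[])

⊤?-reflexive : AlwaysReflexive ⊤?
⊤?-reflexive _ _ _ = refl , λ (p , ¬p) → ¬p p

⊤?-ℕ : CoreflexiveOnℕ ⊤?
⊤?-ℕ _ _ _ (a≡b , _) = a≡b

B₁* : Prog
B₁* = atom 1 *ₚ

B₁*-FRGF : ∀ {S n} → star ∈ S → FRGFProg S n B₁*
B₁*-FRGF star∈S = frgfProg tt (star∈S , tt) tt

B₁*-reflexive : AlwaysReflexive B₁*
B₁*-reflexive _ _ _ = ε

B₁*-ℕ : CoreflexiveOnℕ B₁*
B₁*-ℕ _ _ _ ε        = refl
B₁*-ℕ _ _ _ (() ◅ _)

B̄⁺ : Prog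
B̄⁺ = catom 0 ⁺ₚ

B̄⁺-FRGF : ∀ {S n} → plus ∈ S → conv ∈ S → FRGFProg S n B̄⁺
B̄⁺-FRGF plus∈S conv∈S = frgfProg tt (plus∈S , conv∈S) tt

B̄⁺-relates : RelatesCycleSteps B̄⁺
B̄⁺-relates _ _ _ _ _ y→⁺x = reverse⁺ y→⁺x

B̄⁺-ℕ : MissesSuccessorOnℕ B̄⁺
B̄⁺-ℕ _ a b a>⁺b b≡1+a = <-asym (succ⁺⇒< (reverse⁺ a>⁺b)) (≤-reflexive (sym b≡1+a))

B⁺∘B : Prog
B⁺∘B = (B ⁺ₚ) ∘ₚ B

B⁺∘B-FRGF : ∀ {S n} → plus ∈ S → comp ∈ S → FRGFProg S n B⁺∘B
B⁺∘B-FRGF plus∈S comp∈S = frgfProg (tt , tt) (comp∈S , (plus∈S , tt) , tt) (tt , tt)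

B⁺∘B-relates : RelatesCycleSteps B⁺∘B
B⁺∘B-relates _ _ x _ Bxy y→⁺x = x , Bxy ∷ y→⁺x , Bxy

B⁺∘B-ℕ : MissesSuccessorOnℕ B⁺∘B
B⁺∘B-ℕ _ a b (c , a<⁺c , b≡1+c) b≡1+a =
  <-irrefl (suc-injective (trans (sym b≡1+a) b≡1+c)) (succ⁺⇒< a<⁺c)

lemma6 : NoFMP (plus ∷ test ∷ [])
         × NoFMP (plus ∷ star ∷ [])
         × NoFMP (plus ∷ conv ∷ [])
         × NoFMP (plus ∷ comp ∷ [])
lemma6 =
  reflexiveWitness-NoFMP ⊤?   plus∈ (⊤?-FRGF other∈) ⊤?-reflexive ⊤?-ℕ ,
  reflexiveWitness-NoFMP B₁*  plus∈ (B₁*-FRGF other∈) B₁*-reflexive B₁*-ℕ ,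
  cyclicWitness-NoFMP    B̄⁺   (B̄⁺-FRGF plus∈ other∈) B̄⁺-relates B̄⁺-ℕ ,
  cyclicWitness-NoFMP    B⁺∘B (B⁺∘B-FRGF plus∈ other∈) B⁺∘B-relates B⁺∘B-ℕ
  where
  plus∈ : ∀ {o} → plus ∈ plus ∷ o ∷ []
  plus∈ = here refl

  other∈ : ∀ {o} → o ∈ plus ∷ o ∷ []
  other∈ = there (here refl)
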